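{- Let $A\subseteq\omega$ and suppose $A$ is not intrinsically small. Then the principal function $p_A$ of $A$ is weakly computably traced, i.e. there are total computable functions $g$ and $h$ such that $|D_{g(n)}|\leq h(n)$ for all $n$ and $p_A(n)\in D_{g(n)}$ for infinitely many $n$.
   Context: For $A\subseteq\omega$ and $n\geq 1$, $\rho_n(A)=|A\cap\{0,\dots,n-1\}|/n$ and $\overline{\rho}(A)=\limsup_n\rho_n(A)$. A set $A$ is intrinsically small if $\overline{\rho}(\pi(A))=0$ for every computable permutation $\pi$ of $\omega$. The principal function of an infinite set $A=\{a_0<a_1<\cdots\}$ is $p_A(n)=a_n$. $D_k$ denotes the $k$-th finite set in the canonical indexing of finite sets. -}

module Defs where

open import Data.Nat using (ℕ; zero; suc; _+_; _*_; _^_; _/_; _%_; _≤_; _<_)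
open import Data.Bool using (Bool; true; false; if_then_else_)
open import Data.Fin using (Fin)
open import Data.Vec using (Vec; []; _∷_; lookup)
open import Data.Product using (Σ; ∃; _×_; _,_)
open import Data.Integer using (+_)
import Data.Rational as ℚ
open ℚ using (ℚ; 0ℚ)
open import Relation.Binary.PropositionalEquality using (_≡_)
open import Function.Bundles using (_↔_; Inverse)

data PR : ℕ → Set where
  zer  : ∀ {k} → PR k
  sucF : PR 1
  proj : ∀ {k} → Fin k → PR k
  comp : ∀ {k m} → PR m → Vec (PR k) m → PR k
  prec : ∀ {k} → PR k → PR (suc (suc k)) → PR (suc k)
  mu   : ∀ {k} → PR (suc k) → PR k

mutual
  data _[_]⇓_ : ∀ {k} → PR k → Vec ℕ k → ℕ → Set where
    ev-zer  : ∀ {k} {xs : Vec ℕ k} → zer [ xs ]⇓ 0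
    ev-suc  : ∀ {x} → sucF [ x ∷ [] ]⇓ suc x
    ev-proj : ∀ {k} {i : Fin k} {xs} → proj i [ xs ]⇓ lookup xs i
    ev-comp : ∀ {k m} {f : PR m} {fs : Vec (PR k) m} {xs ys y} →
              fs [ xs ]⇓* ys → f [ ys ]⇓ y → comp f fs [ xs ]⇓ y
    ev-prz  : ∀ {k} {f : PR k} {g xs y} →
              f [ xs ]⇓ y → prec f g [ 0 ∷ xs ]⇓ y
    ev-prs  : ∀ {k} {f : PR k} {g xs n y z} →
              prec f g [ n ∷ xs ]⇓ y → g [ n ∷ y ∷ xs ]⇓ z →
              prec f g [ suc n ∷ xs ]⇓ z
    ev-mu   : ∀ {k} {f : PR (suc k)} {xs n} →
              f [ n ∷ xs ]⇓ 0 →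
              (∀ i → i < n → Σ ℕ λ v → f [ i ∷ xs ]⇓ suc v) →
              mu f [ xs ]⇓ n

  data _[_]⇓*_ : ∀ {k m} → Vec (PR k) m → Vec ℕ k → Vec ℕ m → Set where
    []  : ∀ {k} {xs : Vec ℕ k} → [] [ xs ]⇓* []
    _∷_ : ∀ {k m} {f : PR k} {fs : Vec (PR k) m} {xs y ys} →
          f [ xs ]⇓ y → fs [ xs ]⇓* ys → (f ∷ fs) [ xs ]⇓* (y ∷ ys)

Computable : (ℕ → ℕ) → Set
Computable f = Σ (PR 1) λ c → ∀ n → c [ n ∷ [] ]⇓ f n

record ComputablePerm : Set where
  field
    perm       : ℕ ↔ ℕ
    computable : Computable (Inverse.to perm)

count : (ℕ → Bool) → ℕ → ℕ
count A zero    = zero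
count A (suc n) = (if A n then 1 else 0) + count A n

-- ρ_{n+1}(A) = |A ∩ {0,…,n}| / (n+1)   (ρ is only defined for n ≥ 1)
ρ : (ℕ → Bool) → ℕ → ℚ
ρ A n = (+ count A (suc n)) ℚ./ suc n

-- limsup_n ρ_n(A) = 0  (ρ_n ≥ 0, so this is: ρ_n → 0)
UpperDensityZero : (ℕ → Bool) → Set
UpperDensityZero A = ∀ (ε : ℚ) → 0ℚ ℚ.< ε → Σ ℕ λ N → ∀ n → N ≤ n → ρ A n ℚ.< ε

image : ComputablePerm → (ℕ → Bool) → (ℕ → Bool)
image π A x = A (Inverse.from (ComputablePerm.perm π) x)

IntrinsicallySmall : (ℕ → Bool) → Set
IntrinsicallySmall A = ∀ (π : ComputablePerm) → UpperDensityZero (image π A)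

IsPrincipalValue : (ℕ → Bool) → ℕ → ℕ → Set
IsPrincipalValue A n a = (A a ≡ true) × (count A a ≡ n)

-- Canonical indexing of finite sets: x ∈ D_k iff bit x of k is 1
-- (bit x of k = ⌊k / 2^x⌋ mod 2, computed by repeated halving)
_∈D_ : ℕ → ℕ → Bool
zero  ∈D k with k % 2
... | zero  = false
... | suc _ = true
suc x ∈D k = x ∈D (k / 2)

-- |D_k| ; all elements of D_k are < k (2^x > x), so count up to k suffices
∣D_∣ : ℕ → ℕ
∣D k ∣ = count (_∈D k) k

WeaklyComputablyTracedPrincipal : (ℕ → Bool) → Set
WeaklyComputablyTracedPrincipal A =
  Σ (ℕ → ℕ) λ g → Σ (ℕ → ℕ) λ h →
    Computable g × Computable h ×
    (∀ n → ∣D g n ∣ ≤ h n) ×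
    (∀ m → Σ ℕ λ n → m ≤ n × Σ ℕ λ a → IsPrincipalValue A n a × (a ∈D g n ≡ true))

-- Let π be a computable permutation with ρ(π(A)) not tending to 0, so ρ_{N+1}(π(A)) ≥ 1/q for
-- infinitely many N. If π(A) has n + 1 elements up to such an N, then N + 1 ≤ (n + 1)q, so π(A)
-- has n + 1 elements below (n + 1)q, and this happens for infinitely many n. Pulling them back
-- along the computable π⁻¹ puts n + 1 elements of A below b(n) = Σ_{x < (n+1)q} (π⁻¹(x) + 1),
-- hence p_A(n) < b(n) infinitely often. The trace is D_{2^{b(n)} − 1} = {0, …, b(n) − 1};
-- since |D_k| ≤ k, its index also serves as the bound h.
module Submission where

open import Defs
open import Data.Bool using (Bool; true; false; if_then_else_)
open import Data.Nat using (ℕ; zero; suc; pred; _+_; _*_; _∸_; _/_; _%_; _≤_; _<_; z≤n; s≤s; s≤s⁻¹; _≤?_; ∣_-_∣)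
open import Data.Nat.Properties
open import Data.Nat.DivMod using ([m+kn]%n≡m%n; +-distrib-/-∣ʳ; m*n/n≡m)
open import Data.Nat.Divisibility using (divides)
import Data.Integer as ℤ
import Data.Integer.Properties as ℤP
import Data.Rational as ℚ
open ℚ using (ℚ; mkℚ; 0ℚ; ↧ₙ_)
import Data.Rational.Properties as ℚP
open import Data.Rational.Unnormalised using (mkℚᵘ)
import Data.Rational.Unnormalised.Properties as ℚᵘP
open import Data.Fin using (zero; suc)
open import Data.Vec using (Vec; []; _∷_)
open import Data.Product using (∃; _×_; _,_; proj₁; proj₂)
open import Data.Sum using (inj₁; inj₂)
open import Data.Empty using (⊥-elim)
open import Function using (_∘_)
open import Function.Bundles using (_↔_; Inverse; Injection)
open import Function.Definitions using (Injective)
open import Function.Properties.Inverse using (↔-sym; ↔⇒↣)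
open import Relation.Nullary using (¬_; yes; no)
open import Relation.Binary.PropositionalEquality
open import Axiom.ExcludedMiddle using (ExcludedMiddle)
open import Axiom.DoubleNegationElimination using (em⇒dne)
open import Level using (0ℓ)
open import Algebra.Properties.CommutativeSemigroup +-commutativeSemigroup using (x∙yz≈y∙xz)

module _ (em : ExcludedMiddle 0ℓ) where

  ¬∀⇒∃¬ : {X : Set} {P : X → Set} → ¬ (∀ x → P x) → ∃ λ x → ¬ P x
  ¬∀⇒∃¬ ¬∀ = em⇒dne em λ ¬∃ → ¬∀ λ x → em⇒dne em λ ¬Px → ¬∃ (x , ¬Px)

  ¬→⇒×¬ : {P Q : Set} → ¬ (P → Q) → P × ¬ Q
  ¬→⇒×¬ ¬P→Q = em⇒dne em (λ ¬P → ¬P→Q (⊥-elim ∘ ¬P)) , λ q → ¬P→Q λ _ → q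

  ¬eventually⇒frequently : {P : ℕ → Set} → ¬ (∃ λ N → ∀ n → N ≤ n → P n) → ∀ N → ∃ λ n → N ≤ n × ¬ P n
  ¬eventually⇒frequently ¬eventually N =
    let n , ¬[N≤n⇒Pn] = ¬∀⇒∃¬ (¬eventually ∘ (N ,_)) in n , ¬→⇒×¬ ¬[N≤n⇒Pn]

≤-/⇒≤-* : ∀ {ε} c n → 0ℚ ℚ.< ε → ε ℚ.≤ ℤ.+ c ℚ./ suc n → suc n ≤ c * ↧ₙ ε
≤-/⇒≤-* {mkℚ (ℤ.+ zero) _ _} _ _ (ℚ.*<* (ℤ.+<+ ()))
≤-/⇒≤-* {mkℚ ℤ.-[1+ _ ] _ _} _ _ (ℚ.*<* ())
≤-/⇒≤-* {mkℚ (ℤ.+ suc p) d-1 _} c n _ ε≤c/n =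
  ≤-trans (m≤n*m (suc n) (suc p)) (ℤP.drop‿+≤+ (subst (ℤ.+ (suc p * suc n) ℤ.≤_) (sym (ℤP.pos-* c (suc d-1))) cross))
  where
  -- c / (n + 1) is stored in lowest terms, so compare ε with the unnormalised fraction instead
  cross : ℤ.+ suc p ℤ.* ℤ.+ suc n ℤ.≤ ℤ.+ c ℤ.* ℤ.+ suc d-1
  cross = ℚᵘP.drop-*≤* (ℚᵘP.≤-respʳ-≃ (ℚP.toℚᵘ-fromℚᵘ (mkℚᵘ (ℤ.+ c) n)) (ℚP.toℚᵘ-mono-≤ ε≤c/n))

𝟙 : Bool → ℕ
𝟙 b = if b then 1 else 0

count-≤ : ∀ A n → count A n ≤ n
count-≤ A zero = z≤n
count-≤ A (suc n) with A n
... | true  = s≤s (count-≤ A n)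
... | false = m≤n⇒m≤1+n (count-≤ A n)

count-mono : ∀ A {m n} → m ≤ n → count A m ≤ count A n
count-mono A {n = zero} z≤n = z≤n
count-mono A {n = suc n} m≤1+n with m≤n⇒m<n∨m≡n m≤1+n
... | inj₁ (s≤s m≤n) = ≤-trans (count-mono A m≤n) (m≤n+m (count A n) (𝟙 (A n)))
... | inj₂ refl      = ≤-refl

count-cong : ∀ {A B} n → (∀ {x} → x < n → A x ≡ B x) → count A n ≡ count B n
count-cong zero    A≡B = refl
count-cong (suc n) A≡B = cong₂ (λ b c → 𝟙 b + c) (A≡B ≤-refl) (count-cong n (A≡B ∘ m≤n⇒m≤1+n))

remove : (ℕ → Bool) → ℕ → ℕ → Bool
remove A y x with x ≟ y
... | yes _ = false
... | no  _ = A x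

remove-same : ∀ A y → remove A y y ≡ false
remove-same A y with y ≟ y
... | yes _  = refl
... | no y≢y = ⊥-elim (y≢y refl)

remove-other : ∀ A {x y} → x ≢ y → remove A y x ≡ A x
remove-other A {x} {y} x≢y with x ≟ y
... | yes x≡y = ⊥-elim (x≢y x≡y)
... | no  _   = refl

count-remove : ∀ A {y S} → y < S → count A S ≡ 𝟙 (A y) + count (remove A y) S
count-remove A {y} {suc S} y<1+S with m<1+n⇒m<n∨m≡n y<1+S
... | inj₂ refl = cong₂ (λ b c → 𝟙 (A y) + (𝟙 b + c)) (sym (remove-same A y))
                    (count-cong y λ x<y → sym (remove-other A (<⇒≢ x<y)))
... | inj₁ y<S  = begin
  𝟙 (A S) + count A S                          ≡⟨ cong (𝟙 (A S) +_) (count-remove A y<S) ⟩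
  𝟙 (A S) + (𝟙 (A y) + count (remove A y) S)   ≡⟨ x∙yz≈y∙xz (𝟙 (A S)) (𝟙 (A y)) _ ⟩
  𝟙 (A y) + (𝟙 (A S) + count (remove A y) S)   ≡⟨ cong (λ b → 𝟙 (A y) + (𝟙 b + count (remove A y) S))
                                                       (sym (remove-other A (≢-sym (<⇒≢ y<S)))) ⟩
  𝟙 (A y) + count (remove A y) (suc S)         ∎
  where open ≡-Reasoning

count-∘-injective : ∀ {f S} → Injective _≡_ _≡_ f → ∀ {K} → (∀ {x} → x < K → f x < S) →
                    ∀ A → count (A ∘ f) K ≤ count A S
count-∘-injective f-inj {zero} f<S A = z≤n
count-∘-injective {f} {S} f-inj {suc K} f<S A = begin
  𝟙 (A (f K)) + count (A ∘ f) K      ≡⟨ cong (𝟙 (A (f K)) +_) (count-cong K (sym ∘ remove-other A ∘ f≢fK)) ⟩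
  𝟙 (A (f K)) + count (A′ ∘ f) K     ≤⟨ +-monoʳ-≤ (𝟙 (A (f K))) (count-∘-injective f-inj (f<S ∘ m≤n⇒m≤1+n) A′) ⟩
  𝟙 (A (f K)) + count A′ S           ≡⟨ count-remove A (f<S ≤-refl) ⟨
  count A S                          ∎
  where
  open ≤-Reasoning
  A′ = remove A (f K)
  f≢fK : ∀ {x} → x < K → f x ≢ f K
  f≢fK x<K = <⇒≢ x<K ∘ f-inj

principal-value-below : ∀ A {n} S → suc n ≤ count A S → ∃ λ a → a < S × IsPrincipalValue A n a
principal-value-below A {n} (suc S) n<count with suc n ≤? count A S
... | yes n<count′ = let a , a<S , pa = principal-value-below A S n<count′ in a , m≤n⇒m≤1+n a<S , pa
... | no  n≮count with A S in AS
...   | true  = S , ≤-refl , AS , ≤-antisym (s≤s⁻¹ (≰⇒> n≮count)) (s≤s⁻¹ n<count)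
...   | false = ⊥-elim (n≮count n<count)

∑< : (ℕ → ℕ) → ℕ → ℕ
∑< f zero    = 0
∑< f (suc K) = f K + ∑< f K

≤-∑< : ∀ f {x K} → x < K → f x ≤ ∑< f K
≤-∑< f {x} {suc K} x<1+K with m<1+n⇒m<n∨m≡n x<1+K
... | inj₁ x<K = ≤-trans (≤-∑< f x<K) (m≤n+m (∑< f K) (f K))
... | inj₂ refl = m≤m+n (f x) (∑< f x)

IoDense : ℕ → (ℕ → Bool) → Set
IoDense q B = ∀ N → ∃ λ n → N ≤ n × suc n ≤ count B (suc n) * q

¬density-zero⇒io-dense : ExcludedMiddle 0ℓ → ∀ B → ¬ UpperDensityZero B → ∃ λ q → IoDense q B
¬density-zero⇒io-dense em B ¬udz = ↧ₙ ε , λ N →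
  let n , N≤n , ρ≮ε = ¬eventually⇒frequently em ¬eventually N
  in n , N≤n , ≤-/⇒≤-* (count B (suc n)) n 0<ε (ℚP.≮⇒≥ ρ≮ε)
  where
  ε : ℚ
  ε = proj₁ (¬∀⇒∃¬ em ¬udz)
  0<ε×¬eventually : 0ℚ ℚ.< ε × ¬ (∃ λ N → ∀ n → N ≤ n → ρ B n ℚ.< ε)
  0<ε×¬eventually = ¬→⇒×¬ em (proj₂ (¬∀⇒∃¬ em ¬udz))
  0<ε = proj₁ 0<ε×¬eventually
  ¬eventually = proj₂ 0<ε×¬eventually

io-dense⇒dense-at-multiples : ∀ q B → IoDense q B → ∀ m → ∃ λ n → m ≤ n × suc n ≤ count B (suc n * q)
io-dense⇒dense-at-multiples q B dense m with dense (m * q)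
... | N , mq≤N , 1+N≤cq with count B (suc N) in countEq
...   | zero  = ⊥-elim (1+n≰n (≤-trans 1+N≤cq z≤n))
...   | suc n = n , s≤s⁻¹ (*-cancelʳ-< q m (suc n) (≤-trans (s≤s mq≤N) 1+N≤cq))
              , subst (_≤ count B (suc n * q)) countEq (count-mono B 1+N≤cq)

-- allOnes s = 2ˢ − 1, the canonical index of {0, …, s − 1}
allOnes : ℕ → ℕ
allOnes zero    = 0
allOnes (suc s) = suc (allOnes s * 2)

[1+n*2]%2≡1 : ∀ n → suc (n * 2) % 2 ≡ 1
[1+n*2]%2≡1 n = [m+kn]%n≡m%n 1 n 2

[1+n*2]/2≡n : ∀ n → suc (n * 2) / 2 ≡ n
[1+n*2]/2≡n n = trans (+-distrib-/-∣ʳ 1 {n * 2} {2} (divides n refl)) (m*n/n≡m n 2)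

∈D-allOnes : ∀ {a s} → a < s → a ∈D allOnes s ≡ true
∈D-allOnes {zero}  {suc s} _         rewrite [1+n*2]%2≡1 (allOnes s) = refl
∈D-allOnes {suc a} {suc s} (s≤s a<s) rewrite [1+n*2]/2≡n (allOnes s) = ∈D-allOnes a<s

constᴾ : ∀ {k} → ℕ → PR k
constᴾ zero    = zer
constᴾ (suc c) = comp sucF (constᴾ c ∷ [])

constᴾ-⇓ : ∀ {k} c {xs : Vec ℕ k} → constᴾ c [ xs ]⇓ c
constᴾ-⇓ zero    = ev-zer
constᴾ-⇓ (suc c) = ev-comp (constᴾ-⇓ c ∷ []) ev-suc

+ᴾ : PR 2
+ᴾ = prec (proj zero) (comp sucF (proj (suc zero) ∷ []))

+ᴾ-⇓ : ∀ m n → +ᴾ [ m ∷ n ∷ [] ]⇓ (m + n)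
+ᴾ-⇓ zero    n = ev-prz ev-proj
+ᴾ-⇓ (suc m) n = ev-prs (+ᴾ-⇓ m n) (ev-comp (ev-proj ∷ []) ev-suc)

predᴾ : PR 1
predᴾ = prec zer (proj zero)

predᴾ-⇓ : ∀ n → predᴾ [ n ∷ [] ]⇓ pred n
predᴾ-⇓ zero    = ev-prz ev-zer
predᴾ-⇓ (suc n) = ev-prs (predᴾ-⇓ n) ev-proj

-- recursion on the subtrahend, which therefore comes first
∸ᴾ : PR 2
∸ᴾ = prec (proj zero) (comp predᴾ (proj (suc zero) ∷ []))

∸ᴾ-⇓ : ∀ n m → ∸ᴾ [ n ∷ m ∷ [] ]⇓ (m ∸ n)
∸ᴾ-⇓ zero    m = ev-prz ev-proj
∸ᴾ-⇓ (suc n) m = ev-prs (∸ᴾ-⇓ n m)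
  (ev-comp (ev-proj ∷ []) (subst (predᴾ [ m ∸ n ∷ [] ]⇓_) (pred[m∸n]≡m∸[1+n] m n) (predᴾ-⇓ (m ∸ n))))

∣m-n∣≡[n∸m]+[m∸n] : ∀ m n → ∣ m - n ∣ ≡ (n ∸ m) + (m ∸ n)
∣m-n∣≡[n∸m]+[m∸n] zero    zero    = refl
∣m-n∣≡[n∸m]+[m∸n] zero    (suc n) = sym (+-identityʳ (suc n))
∣m-n∣≡[n∸m]+[m∸n] (suc m) zero    = refl
∣m-n∣≡[n∸m]+[m∸n] (suc m) (suc n) = ∣m-n∣≡[n∸m]+[m∸n] m n

∣-∣ᴾ : PR 2
∣-∣ᴾ = comp +ᴾ (∸ᴾ ∷ comp ∸ᴾ (proj (suc zero) ∷ proj zero ∷ []) ∷ [])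

∣-∣ᴾ-⇓ : ∀ m n → ∣-∣ᴾ [ m ∷ n ∷ [] ]⇓ ∣ m - n ∣
∣-∣ᴾ-⇓ m n = subst (∣-∣ᴾ [ m ∷ n ∷ [] ]⇓_) (sym (∣m-n∣≡[n∸m]+[m∸n] m n))
  (ev-comp (∸ᴾ-⇓ m n ∷ ev-comp (ev-proj ∷ ev-proj ∷ []) (∸ᴾ-⇓ n m) ∷ []) (+ᴾ-⇓ (n ∸ m) (m ∸ n)))

computable-suc : Computable suc
computable-suc = sucF , λ _ → ev-suc

computable-∘ : ∀ {f g} → Computable f → Computable g → Computable (f ∘ g)
computable-∘ {f} {g} (c , c⇓) (d , d⇓) = comp c (d ∷ []) , λ n → ev-comp (d⇓ n ∷ []) (c⇓ (g n))

computable-prec : ∀ {f} (s : PR 2) → (∀ n → s [ n ∷ f n ∷ [] ]⇓ f (suc n)) → Computable f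
computable-prec {f} s s⇓ = prec (constᴾ (f 0)) s , f⇓
  where
  f⇓ : ∀ n → prec (constᴾ (f 0)) s [ n ∷ [] ]⇓ f n
  f⇓ zero    = ev-prz (constᴾ-⇓ (f 0))
  f⇓ (suc n) = ev-prs (f⇓ n) (s⇓ n)

computable-*ʳ : ∀ q → Computable (_* q)
computable-*ʳ q = computable-prec (comp +ᴾ (constᴾ q ∷ proj (suc zero) ∷ []))
  λ n → ev-comp (constᴾ-⇓ q ∷ ev-proj ∷ []) (+ᴾ-⇓ q (n * q))

computable-∑< : ∀ {f} → Computable f → Computable (∑< f)
computable-∑< {f} (c , c⇓) = computable-prec (comp +ᴾ (comp c (proj zero ∷ []) ∷ proj (suc zero) ∷ []))
  λ K → ev-comp (ev-comp (ev-proj ∷ []) (c⇓ K) ∷ ev-proj ∷ []) (+ᴾ-⇓ (f K) (∑< f K))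

computable-allOnes : Computable allOnes
computable-allOnes =
  let double , double⇓ = computable-*ʳ 2
  in computable-prec (comp sucF (comp double (proj (suc zero) ∷ []) ∷ []))
       λ s → ev-comp (ev-comp (ev-proj ∷ []) (double⇓ (allOnes s)) ∷ []) ev-suc

-- π⁻¹(x) is found by unbounded search for the y with ∣π(y) − x∣ = 0.
computable-inverse : (π : ℕ ↔ ℕ) → Computable (Inverse.to π) → Computable (Inverse.from π)
computable-inverse π (c , c⇓) = mu search , λ x → ev-mu (found x) (missed x)
  where
  open Inverse π
  search : PR 2
  search = comp ∣-∣ᴾ (comp c (proj zero ∷ []) ∷ proj (suc zero) ∷ [])
  search-⇓ : ∀ y x → search [ y ∷ x ∷ [] ]⇓ ∣ to y - x ∣
  search-⇓ y x = ev-comp (ev-comp (ev-proj ∷ []) (c⇓ y) ∷ ev-proj ∷ []) (∣-∣ᴾ-⇓ (to y) x)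
  found : ∀ x → search [ from x ∷ x ∷ [] ]⇓ 0
  found x = subst (search [ from x ∷ x ∷ [] ]⇓_) (m≡n⇒∣m-n∣≡0 (strictlyInverseˡ x)) (search-⇓ (from x) x)
  missed : ∀ x i → i < from x → ∃ λ v → search [ i ∷ x ∷ [] ]⇓ suc v
  missed x i i<from with ∣ to i - x ∣ in distance
  ... | zero  = ⊥-elim (<⇒≢ i<from (trans (sym (strictlyInverseʳ i)) (cong from (∣m-n∣≡0⇒m≡n distance))))
  ... | suc v = v , subst (search [ i ∷ x ∷ [] ]⇓_) distance (search-⇓ i x)

lemma3p3 : ExcludedMiddle 0ℓ → (A : ℕ → Bool) →
    ¬ IntrinsicallySmall A → WeaklyComputablyTracedPrincipal A
lemma3p3 em A ¬small = g , g , computable-g , computable-g , (λ n → count-≤ (_∈D g n) (g n)) , traced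
  where
  π : ComputablePerm
  π = proj₁ (¬∀⇒∃¬ em ¬small)
  open ComputablePerm π
  open Inverse perm using (from)
  q,dense : ∃ λ q → IoDense q (A ∘ from)
  q,dense = ¬density-zero⇒io-dense em (A ∘ from) (proj₂ (¬∀⇒∃¬ em ¬small))
  q : ℕ
  q = proj₁ q,dense
  bound : ℕ → ℕ
  bound n = ∑< (suc ∘ from) (suc n * q)
  g : ℕ → ℕ
  g = allOnes ∘ bound
  computable-g : Computable g
  computable-g = computable-∘ computable-allOnes
    (computable-∘ (computable-∑< (computable-∘ computable-suc (computable-inverse perm computable)))
                  (computable-∘ (computable-*ʳ q) computable-suc))
  traced : ∀ m → ∃ λ n → m ≤ n × ∃ λ a → IsPrincipalValue A n a × (a ∈D g n ≡ true)
  traced m =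
    let n , m≤n , dense-n = io-dense⇒dense-at-multiples q (A ∘ from) (proj₂ q,dense) m
        a , a<bound , pa  = principal-value-below A (bound n)
                              (≤-trans dense-n (count-∘-injective (Injection.injective (↔⇒↣ (↔-sym perm))) (≤-∑< (suc ∘ from)) A))
    in n , m≤n , a , pa , ∈D-allOnes a<bound
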